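{- Let $\varepsilon=\pm1$ and $n\ge2$. Then $$\sum_{\sigma\in\mathcal{D}^D_n}\varepsilon^{\ell_D(\sigma)}q^{\mathrm{Dmaj}(\sigma)}=\sum_{\sigma\in\mathcal{D}^\Delta_n}\varepsilon^{\ell_B(\sigma)}(\varepsilon q)^{\mathrm{fmaj}(\sigma)}+\frac{\varepsilon}{2}\left(\sum_{\sigma\in\mathcal{D}^B_{n-1}}\varepsilon^{\ell_B(\sigma)}q^{\mathrm{fmaj}(\sigma)}-\sum_{\sigma\in\mathcal{D}^B_{n-1}}\varepsilon^{\ell_B(\sigma)}(-q)^{\mathrm{fmaj}(\sigma)}\right).$$
   Context: $B_n$ is the group of signed permutations $\sigma=\sigma_1\cdots\sigma_n$ of $[n]$, $D_n$ the subgroup with an even number of negative entries, and $\Delta_n=\{\sigma\in B_n:\sigma_n>0\}$. $\mathcal{D}^B_n,\mathcal{D}^D_n,\mathcal{D}^\Delta_n$ denote the elements $\sigma$ of $B_n,D_n,\Delta_n$ respectively with $\sigma_i\ne i$ for all $i$. $\mathrm{neg}(\sigma)=\#\{i:\sigma_i<0\}$, $\ell_B(\sigma)=\mathrm{inv}(\sigma)-\sum_{i:\sigma_i<0}\sigma_i$ ($\mathrm{inv}$ = number of pairs $i<j$ with $\sigma_i>\sigma_j$ in the usual integer order), $\ell_D(\sigma)=\ell_B(\sigma)-\mathrm{neg}(\sigma)$. With the order $-1\prec-2\prec\cdots\prec-n\prec1\prec\cdots\prec n$, $\mathrm{maj}_\prec(\sigma)=\sum\{i:\sigma_{i+1}\prec\sigma_i\}$,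 $\mathrm{fmaj}(\sigma)=2\mathrm{maj}_\prec(\sigma)+\mathrm{neg}(\sigma)$, $\mathrm{Dmaj}(\sigma)=\mathrm{fmaj}(\sigma_1\cdots\sigma_{n-1}|\sigma_n|)$. -}

module Defs where

open import Data.Bool using (Bool; true; false; if_then_else_; _∧_; not)
open import Data.Nat as ℕ using (ℕ; zero; suc; _∸_; _<ᵇ_; _≡ᵇ_)

open import Data.Integer as ℤ using (ℤ; +_; -[1+_]; ∣_∣)
open import Data.List using (List; []; _∷_; map; concatMap; filterᵇ; foldr; length; upTo)
open import Data.Rational as ℚ using (ℚ)
open import Relation.Binary.PropositionalEquality using (_≡_)

-- Signed permutations are written in one-line notation as lists of
-- nonzero integers σ₁ ⋯ σₙ.

insertAll : {A : Set} → A → List A → List (List A)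
insertAll x [] = (x ∷ []) ∷ []
insertAll x (y ∷ ys) = (x ∷ y ∷ ys) ∷ map (y ∷_) (insertAll x ys)

perms : {A : Set} → List A → List (List A)
perms [] = [] ∷ []
perms (x ∷ xs) = concatMap (insertAll x) (perms xs)

signings : List ℕ → List (List ℤ)
signings [] = [] ∷ []
signings (x ∷ xs) = concatMap (λ s → (+ x ∷ s) ∷ (ℤ.- (+ x) ∷ s) ∷ []) (signings xs)

oneTo : ℕ → List ℕ
oneTo n = map suc (upTo n)

-- the hyperoctahedral group B_n (each element listed exactly once)
Bgroup : ℕ → List (List ℤ)
Bgroup n = concatMap signings (perms (oneTo n))

isNeg : ℤ → Bool
isNeg (+ _) = false
isNeg -[1+ _ ] = true

neg : List ℤ → ℕ
neg w = length (filterᵇ isNeg w)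

even : ℕ → Bool
even zero = true
even (suc n) = not (even n)

lastPositive : List ℤ → Bool
lastPositive [] = false
lastPositive (x ∷ []) = not (isNeg x)
lastPositive (x ∷ y ∷ ys) = lastPositive (y ∷ ys)

Dgroup : ℕ → List (List ℤ)
Dgroup n = filterᵇ (λ σ → even (neg σ)) (Bgroup n)

Deltaset : ℕ → List (List ℤ)
Deltaset n = filterᵇ lastPositive (Bgroup n)

noFixFrom : ℕ → List ℤ → Bool
noFixFrom i [] = true
noFixFrom i (x ∷ xs) = not ((x ℤ.≤ᵇ (+ i)) ∧ ((+ i) ℤ.≤ᵇ x)) ∧ noFixFrom (suc i) xs

derangements : List (List ℤ) → List (List ℤ)
derangements = filterᵇ (noFixFrom 1)

DerB DerD DerΔ : ℕ → List (List ℤ)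
DerB n = derangements (Bgroup n)
DerD n = derangements (Dgroup n)
DerΔ n = derangements (Deltaset n)

_<ℤᵇ_ : ℤ → ℤ → Bool
y <ℤᵇ x = (y ℤ.≤ᵇ x) ∧ not (x ℤ.≤ᵇ y)

-- inv(σ) = #{ i < j : σ_i > σ_j } (usual integer order)
inv : List ℤ → ℕ
inv [] = 0
inv (x ∷ xs) = length (filterᵇ (λ y → y <ℤᵇ x) xs) ℕ.+ inv xs

negAbsSum : List ℤ → ℕ
negAbsSum [] = 0
negAbsSum (x ∷ xs) = (if isNeg x then ∣ x ∣ else 0) ℕ.+ negAbsSum xs

ellB : List ℤ → ℕ
ellB σ = inv σ ℕ.+ negAbsSum σ

ellD : List ℤ → ℕ
ellD σ = ellB σ ∸ neg σ

-- x ≺ y in the order -1 ≺ -2 ≺ ⋯ ≺ -n ≺ 1 ≺ ⋯ ≺ n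
_≺ᵇ_ : ℤ → ℤ → Bool
-[1+ a ] ≺ᵇ -[1+ b ] = a <ᵇ b
-[1+ _ ] ≺ᵇ (+ _) = true
(+ _) ≺ᵇ -[1+ _ ] = false
(+ a) ≺ᵇ (+ b) = a <ᵇ b

majFrom : ℕ → List ℤ → ℕ
majFrom i [] = 0
majFrom i (x ∷ []) = 0
majFrom i (x ∷ y ∷ ys) = (if y ≺ᵇ x then i else 0) ℕ.+ majFrom (suc i) (y ∷ ys)

majPrec : List ℤ → ℕ
majPrec = majFrom 1

fmaj : List ℤ → ℕ
fmaj σ = 2 ℕ.* majPrec σ ℕ.+ neg σ

absLast : List ℤ → List ℤ
absLast [] = []
absLast (x ∷ []) = (+ ∣ x ∣) ∷ []
absLast (x ∷ y ∷ ys) = x ∷ absLast (y ∷ ys)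

Dmaj : List ℤ → ℕ
Dmaj σ = fmaj (absLast σ)

-- Polynomials in q with rational coefficients, represented by their
-- coefficient sequences (finitely supported in all uses below).
Poly : Set
Poly = ℕ → ℚ

-- Σ_{σ ∈ S} c(σ) q^{e(σ)} : coefficient of q^k is Σ_{σ ∈ S, e(σ) = k} c(σ)
genfun : List (List ℤ) → (List ℤ → ℤ) → (List ℤ → ℕ) → Poly
genfun S c e k = foldr (λ σ acc → (if e σ ≡ᵇ k then c σ ℚ./ 1 else ℚ.0ℚ) ℚ.+ acc) ℚ.0ℚ S

_+ₚ_ : Poly → Poly → Poly
(f +ₚ g) k = f k ℚ.+ g k

_-ₚ_ : Poly → Poly → Poly
(f -ₚ g) k = f k ℚ.- g k

_·ₚ_ : ℚ → Poly → Poly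
(a ·ₚ f) k = a ℚ.* f k

_≈ₚ_ : Poly → Poly → Set
f ≈ₚ g = ∀ k → f k ≡ g k

infixl 6 _+ₚ_ _-ₚ_
infixr 7 _·ₚ_
infix 4 _≈ₚ_

-- Pair each σ ∈ Δ_n with σ̄, the same word with its last entry negated; these pairs partition B_n.
-- Dmaj ignores that sign, exactly one of σ, σ̄ lies in D_n, and ℓ_D(σ̄) = ℓ_D(σ) + 2(σ_n − 1), so both
-- carry ε^ℓ_D(σ) = ε^ℓ_B(σ) ε^fmaj(σ), the weight of σ on the Δ_n side. σ and σ̄ are derangements
-- together, except when σ_n = n: then σ = σ′n is fixed at n, and σ̄ = σ′(−n) ∈ 𝒟^D_n exactly when
-- σ′ ∈ 𝒟^B_{n−1} has odd neg(σ′), i.e. odd fmaj(σ′). Its weight ε^ℓ_B(σ′) ε^fmaj(σ′) is then the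
-- term (ε/2)(1 − (−1)^fmaj(σ′)) ε^ℓ_B(σ′) of the correction, which vanishes for even fmaj(σ′).

{-# OPTIONS --safe #-}
module Submission where

open import Defs
import Algebra.Properties.CommutativeSemigroup as CommSemigroupProperties
open import Data.Bool using (Bool; true; false; if_then_else_; _∧_; not)
import Data.Bool.Properties as Bool
open import Data.Nat as ℕ using (ℕ; zero; suc; _+_; _*_; _∸_; _≤_; _<_; z≤n; s≤s; _≡ᵇ_; _<ᵇ_; _≤ᵇ_; _⊓_; pred)
import Data.Nat.Properties as ℕ
open import Data.Nat.Tactic.RingSolver using (solve-∀)
open import Data.Integer as ℤ using (ℤ; +_; -[1+_]; ∣_∣; -1ℤ; 1ℤ; _^_)
import Data.Integer.Properties as ℤ
open import Data.Rational as ℚ using (ℚ; 0ℚ; ½; _/_)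
import Data.Rational.Properties as ℚ
open import Data.Rational.Solver using (module +-*-Solver)
open import Data.List using (List; []; _∷_; _++_; _∷ʳ_; [_]; map; concatMap; filterᵇ; foldr; length; upTo; initLast; _∷ʳ′_)
import Data.List.Properties as List
open import Data.List.Relation.Unary.All as All using (All; []; _∷_)
import Data.List.Relation.Unary.All.Properties as All
open import Data.List.Relation.Unary.Unique.Propositional using (Unique; []; _∷_)
import Data.List.Relation.Unary.Unique.Propositional.Properties as Unique
open import Data.List.Relation.Binary.Permutation.Propositional
  using (_↭_; ↭⇒↭ₛ; ↭-sym; ↭-refl; ↭-trans; ↭-prep; ↭-swap)
open import Data.List.Relation.Binary.Permutation.Propositional.Properties using (↭-length; filter-↭; All-resp-↭)
import Data.List.Relation.Binary.Permutation.Setoid.Properties as PermutationSetoid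
open import Data.Product using (_×_; _,_; proj₁; proj₂)
open import Data.Sum using (_⊎_; inj₁; inj₂)
open import Function using (_∘_; Equivalence)
open import Relation.Nullary using (contradiction)
open import Relation.Nullary.Decidable using (T?)
open import Relation.Binary.PropositionalEquality
  using (_≡_; _≢_; refl; sym; trans; cong; cong₂; subst; module ≡-Reasoning; setoid)

module ℕ+ = CommSemigroupProperties ℕ.+-commutativeSemigroup

infixr 6.5 _▸_

_▸_ : Bool → ℚ → ℚ
b ▸ q = if b then q else 0ℚ

▸-0ℚ : ∀ b → b ▸ 0ℚ ≡ 0ℚ
▸-0ℚ true  = refl
▸-0ℚ false = refl

▸-split : ∀ b q → b ▸ q ℚ.+ not b ▸ q ≡ q
▸-split true  q = ℚ.+-identityʳ q
▸-split false q = ℚ.+-identityˡ q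

∧-▸ : ∀ b c q → (b ∧ c) ▸ q ≡ b ▸ c ▸ q
∧-▸ true  c q = refl
∧-▸ false c q = refl

▸-cong₃ : ∀ {a a′ b b′ c c′ q q′} → a ≡ a′ → b ≡ b′ → c ≡ c′ → q ≡ q′ →
          a ▸ b ▸ c ▸ q ≡ a′ ▸ b′ ▸ c′ ▸ q′
▸-cong₃ refl refl refl refl = refl

∑ : {A : Set} → List A → (A → ℚ) → ℚ
∑ xs f = foldr (λ x acc → f x ℚ.+ acc) 0ℚ xs

syntax ∑ xs (λ x → e) = ∑[ x ∈ xs ] e

module _ {A : Set} where

  ∑-++ : (xs ys : List A) (f : A → ℚ) → ∑ (xs ++ ys) f ≡ ∑ xs f ℚ.+ ∑ ys f
  ∑-++ []       ys f = sym (ℚ.+-identityˡ _)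
  ∑-++ (x ∷ xs) ys f = trans (cong (f x ℚ.+_) (∑-++ xs ys f)) (sym (ℚ.+-assoc (f x) _ _))

  ∑-map : {B : Set} (g : B → A) (xs : List B) (f : A → ℚ) → ∑ (map g xs) f ≡ ∑ xs (f ∘ g)
  ∑-map g []       f = refl
  ∑-map g (x ∷ xs) f = cong (f (g x) ℚ.+_) (∑-map g xs f)

  ∑-concatMap : {B : Set} (g : B → List A) (xs : List B) (f : A → ℚ) →
    ∑ (concatMap g xs) f ≡ ∑[ x ∈ xs ] ∑ (g x) f
  ∑-concatMap g []       f = refl
  ∑-concatMap g (x ∷ xs) f = trans (∑-++ (g x) _ f) (cong (∑ (g x) f ℚ.+_) (∑-concatMap g xs f))

  ∑-filterᵇ : (P : A → Bool) (xs : List A) (f : A → ℚ) → ∑ (filterᵇ P xs) f ≡ ∑[ x ∈ xs ] (P x ▸ f x)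
  ∑-filterᵇ P []       f = refl
  ∑-filterᵇ P (x ∷ xs) f with P x
  ... | true  = cong (f x ℚ.+_) (∑-filterᵇ P xs f)
  ... | false = trans (∑-filterᵇ P xs f) (sym (ℚ.+-identityˡ _))

  ∑-filterᵇ² : (P Q : A → Bool) (xs : List A) (f : A → ℚ) →
    ∑ (filterᵇ P (filterᵇ Q xs)) f ≡ ∑[ x ∈ xs ] (Q x ▸ P x ▸ f x)
  ∑-filterᵇ² P Q xs f = trans (∑-filterᵇ P (filterᵇ Q xs) f) (∑-filterᵇ Q xs (λ x → P x ▸ f x))

  ∑-cong : {P : A → Set} {xs : List A} {f g : A → ℚ} → (∀ {x} → P x → f x ≡ g x) → All P xs → ∑ xs f ≡ ∑ xs g
  ∑-cong f≡g []         = refl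
  ∑-cong f≡g (px ∷ pxs) = cong₂ ℚ._+_ (f≡g px) (∑-cong f≡g pxs)

  ∑-ext : (xs : List A) {f g : A → ℚ} → (∀ x → f x ≡ g x) → ∑ xs f ≡ ∑ xs g
  ∑-ext []       f≡g = refl
  ∑-ext (x ∷ xs) f≡g = cong₂ ℚ._+_ (f≡g x) (∑-ext xs f≡g)

  ∑-+ : (xs : List A) (f g : A → ℚ) → ∑[ x ∈ xs ] (f x ℚ.+ g x) ≡ ∑ xs f ℚ.+ ∑ xs g
  ∑-+ []       f g = refl
  ∑-+ (x ∷ xs) f g = trans (cong (f x ℚ.+ g x ℚ.+_) (∑-+ xs f g)) (shuffle (f x) (g x) _ _)
    where
    open +-*-Solver
    shuffle : ∀ a b c d → (a ℚ.+ b) ℚ.+ (c ℚ.+ d) ≡ (a ℚ.+ c) ℚ.+ (b ℚ.+ d)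
    shuffle = solve 4 (λ a b c d → (a :+ b) :+ (c :+ d) := (a :+ c) :+ (b :+ d)) refl

  ∑-▸ : (b : Bool) (xs : List A) (f : A → ℚ) → ∑[ x ∈ xs ] (b ▸ f x) ≡ b ▸ ∑ xs f
  ∑-▸ true  xs       f = refl
  ∑-▸ false []       f = refl
  ∑-▸ false (x ∷ xs) f = trans (ℚ.+-identityˡ _) (∑-▸ false xs f)

  ∑-*-- : (c : ℚ) (xs : List A) (f g : A → ℚ) → ∑[ x ∈ xs ] (c ℚ.* (f x ℚ.- g x)) ≡ c ℚ.* (∑ xs f ℚ.- ∑ xs g)
  ∑-*-- c []       f g = sym (ℚ.*-zeroʳ c)
  ∑-*-- c (x ∷ xs) f g = trans (cong (c ℚ.* (f x ℚ.- g x) ℚ.+_) (∑-*-- c xs f g)) (distrib c (f x) (g x) _ _)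
    where
    open +-*-Solver
    distrib : ∀ c a b s t → c ℚ.* (a ℚ.- b) ℚ.+ c ℚ.* (s ℚ.- t) ≡ c ℚ.* ((a ℚ.+ s) ℚ.- (b ℚ.+ t))
    distrib = solve 5 (λ c a b s t → c :* (a :- b) :+ c :* (s :- t) := c :* ((a :+ s) :- (b :+ t))) refl

𝟙 : Bool → ℕ
𝟙 true  = 1
𝟙 false = 0

count : {A : Set} → (A → Bool) → List A → ℕ
count P xs = length (filterᵇ P xs)

module _ {A : Set} (P : A → Bool) where

  count-∷ : (x : A) (xs : List A) → count P (x ∷ xs) ≡ 𝟙 (P x) + count P xs
  count-∷ x xs with P x
  ... | true  = refl
  ... | false = refl

  count-∷ʳ : (xs : List A) (x : A) → count P (xs ∷ʳ x) ≡ 𝟙 (P x) + count P xs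
  count-∷ʳ []       x = count-∷ x []
  count-∷ʳ (y ∷ xs) x = begin
    count P (y ∷ xs ∷ʳ x)             ≡⟨ count-∷ y (xs ∷ʳ x) ⟩
    𝟙 (P y) + count P (xs ∷ʳ x)       ≡⟨ cong (_+_ (𝟙 (P y))) (count-∷ʳ xs x) ⟩
    𝟙 (P y) + (𝟙 (P x) + count P xs)  ≡⟨ ℕ+.x∙yz≈y∙xz (𝟙 (P y)) (𝟙 (P x)) (count P xs) ⟩
    𝟙 (P x) + (𝟙 (P y) + count P xs)  ≡⟨ cong (_+_ (𝟙 (P x))) (sym (count-∷ y xs)) ⟩
    𝟙 (P x) + count P (y ∷ xs)        ∎
    where open ≡-Reasoning

  count-↭ : {xs ys : List A} → xs ↭ ys → count P xs ≡ count P ys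
  count-↭ xs↭ys = ↭-length (filter-↭ (T? ∘ P) xs↭ys)

  count-none : {xs : List A} → All (λ x → P x ≡ false) xs → count P xs ≡ 0
  count-none []                  = refl
  count-none {x ∷ _} (px ∷ pxs) rewrite px = count-none pxs

count-split : {A : Set} (P Q R : A → Bool) {xs : List A} →
  All (λ x → 𝟙 (P x) ≡ 𝟙 (Q x) + 𝟙 (R x)) xs → count P xs ≡ count Q xs + count R xs
count-split P Q R []                  = refl
count-split P Q R {x ∷ xs} (px ∷ pxs) = begin
  count P (x ∷ xs)                                    ≡⟨ count-∷ P x xs ⟩
  𝟙 (P x) + count P xs                                ≡⟨ cong₂ _+_ px (count-split P Q R pxs) ⟩
  (𝟙 (Q x) + 𝟙 (R x)) + (count Q xs + count R xs)     ≡⟨ ℕ+.interchange (𝟙 (Q x)) (𝟙 (R x)) (count Q xs) (count R xs) ⟩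
  (𝟙 (Q x) + count Q xs) + (𝟙 (R x) + count R xs)     ≡⟨ sym (cong₂ _+_ (count-∷ Q x xs) (count-∷ R x xs)) ⟩
  count Q (x ∷ xs) + count R (x ∷ xs)                 ∎
  where open ≡-Reasoning

count-map : {A B : Set} (P : B → Bool) (f : A → B) (xs : List A) → count P (map f xs) ≡ count (P ∘ f) xs
count-map P f []       = refl
count-map P f (x ∷ xs) = trans (count-∷ P (f x) (map f xs))
  (trans (cong (_+_ (𝟙 (P (f x)))) (count-map P f xs)) (sym (count-∷ (P ∘ f) x xs)))

≤ᵇ-suc : ∀ m n → (suc m ≤ᵇ suc n) ≡ (m ≤ᵇ n)
≤ᵇ-suc zero    n = refl
≤ᵇ-suc (suc m) n = refl

<ᵇ-via-≤ᵇ : ∀ m n → ((m ≤ᵇ n) ∧ not (n ≤ᵇ m)) ≡ (m <ᵇ n)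
<ᵇ-via-≤ᵇ zero    zero    = refl
<ᵇ-via-≤ᵇ zero    (suc n) = refl
<ᵇ-via-≤ᵇ (suc m) zero    = refl
<ᵇ-via-≤ᵇ (suc m) (suc n) rewrite ≤ᵇ-suc m n | ≤ᵇ-suc n m = <ᵇ-via-≤ᵇ m n

≡ᵇ-via-≤ᵇ : ∀ m n → ((m ≤ᵇ n) ∧ (n ≤ᵇ m)) ≡ (m ≡ᵇ n)
≡ᵇ-via-≤ᵇ zero    zero    = refl
≡ᵇ-via-≤ᵇ zero    (suc n) = refl
≡ᵇ-via-≤ᵇ (suc m) zero    = Bool.∧-zeroʳ (m <ᵇ 0)
≡ᵇ-via-≤ᵇ (suc m) (suc n) rewrite ≤ᵇ-suc m n | ≤ᵇ-suc n m = ≡ᵇ-via-≤ᵇ m n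

≤⇒≮ᵇ : ∀ {m n} → m ≤ n → (n <ᵇ m) ≡ false
≤⇒≮ᵇ z≤n     = refl
≤⇒≮ᵇ (s≤s p) = ≤⇒≮ᵇ p

≡ᵇ-true : ∀ {m n} → m ≡ n → (m ≡ᵇ n) ≡ true
≡ᵇ-true {m} {n} = Equivalence.to Bool.T-≡ ∘ ℕ.≡⇒≡ᵇ m n

≡ᵇ-false : ∀ {m n} → m ≢ n → (m ≡ᵇ n) ≡ false
≡ᵇ-false {m} {n} m≢n = Bool.¬-not (m≢n ∘ ℕ.≡ᵇ⇒≡ m n ∘ Equivalence.from Bool.T-≡)

<ᵇ-trichotomy : ∀ {m n} → m ≢ n → 𝟙 (m <ᵇ n) + 𝟙 (n <ᵇ m) ≡ 1
<ᵇ-trichotomy {zero}  {zero}  m≢n = contradiction refl m≢n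
<ᵇ-trichotomy {zero}  {suc n} _   = refl
<ᵇ-trichotomy {suc m} {zero}  _   = refl
<ᵇ-trichotomy {suc m} {suc n} m≢n = <ᵇ-trichotomy (m≢n ∘ cong suc)

<ℤᵇ-flip : ∀ x {a} → ∣ a ∣ ≢ suc x → 𝟙 (-[1+ x ] <ℤᵇ a) ≡ 𝟙 ((+ suc x) <ℤᵇ a) + 𝟙 (∣ a ∣ <ᵇ suc x)
<ℤᵇ-flip x {+ k}    k≢x rewrite <ᵇ-via-≤ᵇ (suc x) k = sym (<ᵇ-trichotomy (k≢x ∘ sym))
<ℤᵇ-flip x { -[1+ j ]} _   rewrite <ᵇ-via-≤ᵇ j x = refl

<ℤᵇ-bounded : ∀ {n a} → ∣ a ∣ ≤ n → ((+ n) <ℤᵇ a) ≡ false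
<ℤᵇ-bounded {n} {+ k}    k≤n = trans (<ᵇ-via-≤ᵇ n k) (≤⇒≮ᵇ k≤n)
<ℤᵇ-bounded {a = -[1+ j ]} _   = refl

≺ᵇ-bounded : ∀ {n a} → ∣ a ∣ ≤ n → ((+ n) ≺ᵇ a) ≡ false
≺ᵇ-bounded {a = + k}    k≤n = ≤⇒≮ᵇ k≤n
≺ᵇ-bounded {a = -[1+ j ]} _   = refl

length-oneTo : ∀ n → length (oneTo n) ≡ n
length-oneTo n = trans (List.length-map suc (upTo n)) (List.length-applyUpTo (λ i → i) n)

oneTo-suc : ∀ n → oneTo (suc n) ≡ oneTo n ∷ʳ suc n
oneTo-suc n = trans (cong (map suc) (sym (List.applyUpTo-∷ʳ (λ i → i) n))) (List.map-++ suc (upTo n) [ n ])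

oneTo-bounds : ∀ n → All (λ y → 0 < y × y ≤ n) (oneTo n)
oneTo-bounds n = All.map⁺ (All.applyUpTo⁺₁ (λ i → i) n (λ i<n → s≤s z≤n , i<n))

oneTo-unique : ∀ n → Unique (oneTo n)
oneTo-unique n = Unique.map⁺ ℕ.suc-injective (Unique.upTo⁺ n)

count-≤-oneTo : ∀ x n → count (_<ᵇ suc x) (oneTo n) ≡ x ⊓ n
count-≤-oneTo x zero    = sym (ℕ.⊓-zeroʳ x)
count-≤-oneTo x (suc n) = begin
  count (_<ᵇ suc x) (oneTo (suc n))           ≡⟨ cong (count (_<ᵇ suc x)) (oneTo-suc n) ⟩
  count (_<ᵇ suc x) (oneTo n ∷ʳ suc n)        ≡⟨ count-∷ʳ (_<ᵇ suc x) (oneTo n) (suc n) ⟩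
  𝟙 (n <ᵇ x) + count (_<ᵇ suc x) (oneTo n)    ≡⟨ cong (_+_ (𝟙 (n <ᵇ x))) (count-≤-oneTo x n) ⟩
  𝟙 (n <ᵇ x) + x ⊓ n                          ≡⟨ ⊓-suc x n ⟩
  x ⊓ suc n                                   ∎
  where
  open ≡-Reasoning
  ⊓-suc : ∀ x n → 𝟙 (n <ᵇ x) + x ⊓ n ≡ x ⊓ suc n
  ⊓-suc zero    n       = refl
  ⊓-suc (suc x) zero    = cong suc (sym (ℕ.⊓-zeroʳ x))
  ⊓-suc (suc x) (suc n) = trans (ℕ.+-suc (𝟙 (n <ᵇ x)) (x ⊓ n)) (cong suc (⊓-suc x n))

Unique-∷ʳ⇒∉ : {A : Set} {x : A} (xs : List A) → Unique (xs ∷ʳ x) → All (_≢ x) xs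
Unique-∷ʳ⇒∉ []       _          = []
Unique-∷ʳ⇒∉ (y ∷ xs) (y∉ ∷ uxs) = proj₂ (All.∷ʳ⁻ y∉) ∷ Unique-∷ʳ⇒∉ xs uxs

module _ {ys : List ℕ} {x n : ℕ} (arranged : ys ∷ʳ x ↭ oneTo n) where

  ∷ʳ-↭-oneTo⇒length : length ys ≡ pred n
  ∷ʳ-↭-oneTo⇒length = cong pred (begin
    suc (length ys)      ≡⟨ ℕ.+-comm 1 (length ys) ⟩
    length ys + 1        ≡⟨ List.length-++ ys ⟨
    length (ys ∷ʳ x)     ≡⟨ ↭-length arranged ⟩
    length (oneTo n)     ≡⟨ length-oneTo n ⟩
    n                    ∎)
    where open ≡-Reasoning

  ∷ʳ-↭-oneTo⇒bounds : All (λ y → 0 < y × y ≤ n) ys × (0 < x × x ≤ n)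
  ∷ʳ-↭-oneTo⇒bounds = All.∷ʳ⁻ (All-resp-↭ (↭-sym arranged) (oneTo-bounds n))

  ∷ʳ-↭-oneTo⇒fresh : All (_≢ x) ys
  ∷ʳ-↭-oneTo⇒fresh =
    Unique-∷ʳ⇒∉ ys (PermutationSetoid.Unique-resp-↭ (setoid ℕ) (↭⇒↭ₛ (↭-sym arranged)) (oneTo-unique n))

  ∷ʳ-↭-oneTo⇒below : ∀ {x′} → x ≡ suc x′ → count (_<ᵇ x) ys ≡ x′
  ∷ʳ-↭-oneTo⇒below {x′} refl = begin
    count (_<ᵇ suc x′) ys                 ≡⟨ cong (λ b → 𝟙 b + count (_<ᵇ suc x′) ys) (≤⇒≮ᵇ (ℕ.≤-refl {x′})) ⟨
    𝟙 (x′ <ᵇ x′) + count (_<ᵇ suc x′) ys  ≡⟨ count-∷ʳ (_<ᵇ suc x′) ys (suc x′) ⟨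
    count (_<ᵇ suc x′) (ys ∷ʳ suc x′)    ≡⟨ count-↭ (_<ᵇ suc x′) arranged ⟩
    count (_<ᵇ suc x′) (oneTo n)         ≡⟨ count-≤-oneTo x′ n ⟩
    x′ ⊓ n                                ≡⟨ ℕ.m≤n⇒m⊓n≡m (ℕ.<⇒≤ (proj₂ (proj₂ ∷ʳ-↭-oneTo⇒bounds))) ⟩
    x′                                    ∎
    where open ≡-Reasoning

-- Permutations with a prescribed last entry

insertAll-↭ : {A : Set} (x : A) (q : List A) → All (_↭ x ∷ q) (insertAll x q)
insertAll-↭ x []       = ↭-refl ∷ []
insertAll-↭ x (y ∷ ys) =
  ↭-refl ∷ All.map⁺ (All.map (λ r↭ → ↭-trans (↭-prep y r↭) (↭-swap y x ↭-refl)) (insertAll-↭ x ys))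

perms-↭ : {A : Set} (xs : List A) → All (_↭ xs) (perms xs)
perms-↭ []       = ↭-refl ∷ []
perms-↭ (x ∷ xs) =
  All.concat⁺ (All.map⁺ (All.map (λ q↭ → All.map (λ r↭ → ↭-trans r↭ (↭-prep x q↭)) (insertAll-↭ x _)) (perms-↭ xs)))

atLast : ℕ → (List ℕ → ℚ) → List ℕ → ℚ
atLast y G []            = 0ℚ
atLast y G (x ∷ [])      = (x ≡ᵇ y) ▸ G []
atLast y G (x ∷ x′ ∷ xs) = atLast y (G ∘ (x ∷_)) (x′ ∷ xs)

atLast-∷ʳ : ∀ y G xs x → atLast y G (xs ∷ʳ x) ≡ (x ≡ᵇ y) ▸ G xs
atLast-∷ʳ y G []           x = refl
atLast-∷ʳ y G (a ∷ [])     x = refl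
atLast-∷ʳ y G (a ∷ b ∷ xs) x = atLast-∷ʳ y (G ∘ (a ∷_)) (b ∷ xs) x

insertAll-∷ʳ : {A : Set} (x : A) (ys : List A) (z : A) →
  insertAll x (ys ∷ʳ z) ≡ map (_∷ʳ z) (insertAll x ys) ∷ʳ (ys ∷ʳ z ∷ʳ x)
insertAll-∷ʳ x []       z = refl
insertAll-∷ʳ x (y ∷ ys) z = cong ((x ∷ y ∷ ys ∷ʳ z) ∷_) (begin
  map (y ∷_) (insertAll x (ys ∷ʳ z))
    ≡⟨ cong (map (y ∷_)) (insertAll-∷ʳ x ys z) ⟩
  map (y ∷_) (map (_∷ʳ z) (insertAll x ys) ∷ʳ (ys ∷ʳ z ∷ʳ x))
    ≡⟨ List.map-++ (y ∷_) (map (_∷ʳ z) (insertAll x ys)) _ ⟩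
  map (y ∷_) (map (_∷ʳ z) (insertAll x ys)) ∷ʳ (y ∷ ys ∷ʳ z ∷ʳ x)
    ≡⟨ cong (_∷ʳ (y ∷ ys ∷ʳ z ∷ʳ x)) (trans (sym (List.map-∘ (insertAll x ys))) (List.map-∘ (insertAll x ys))) ⟩
  map (_∷ʳ z) (map (y ∷_) (insertAll x ys)) ∷ʳ (y ∷ ys ∷ʳ z ∷ʳ x)
    ∎)
  where open ≡-Reasoning

∑-insertAll-atLast : ∀ {x y} → x ≢ y → (G : List ℕ → ℚ) (q : List ℕ) →
  ∑ (insertAll x q) (atLast y G) ≡ atLast y (λ p → ∑ (insertAll x p) G) q
∑-insertAll-atLast {x} {y} x≢y G q with initLast q
... | []       = cong (λ b → b ▸ G [] ℚ.+ 0ℚ) (≡ᵇ-false x≢y)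
... | ys ∷ʳ′ z = begin
  ∑ (insertAll x (ys ∷ʳ z)) (atLast y G)
    ≡⟨ cong (λ l → ∑ l (atLast y G)) (insertAll-∷ʳ x ys z) ⟩
  ∑ (map (_∷ʳ z) (insertAll x ys) ∷ʳ (ys ∷ʳ z ∷ʳ x)) (atLast y G)
    ≡⟨ ∑-++ (map (_∷ʳ z) (insertAll x ys)) _ (atLast y G) ⟩
  ∑ (map (_∷ʳ z) (insertAll x ys)) (atLast y G) ℚ.+ (atLast y G (ys ∷ʳ z ∷ʳ x) ℚ.+ 0ℚ)
    ≡⟨ cong₂ ℚ._+_ (∑-map (_∷ʳ z) (insertAll x ys) (atLast y G)) (ℚ.+-identityʳ _) ⟩
  ∑[ r ∈ insertAll x ys ] atLast y G (r ∷ʳ z) ℚ.+ atLast y G (ys ∷ʳ z ∷ʳ x)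
    ≡⟨ cong₂ ℚ._+_ (∑-ext (insertAll x ys) (λ r → atLast-∷ʳ y G r z)) (atLast-∷ʳ y G (ys ∷ʳ z) x) ⟩
  ∑[ r ∈ insertAll x ys ] ((z ≡ᵇ y) ▸ G r) ℚ.+ (x ≡ᵇ y) ▸ G (ys ∷ʳ z)
    ≡⟨ cong₂ ℚ._+_ (∑-▸ (z ≡ᵇ y) (insertAll x ys) G) (cong (_▸ G (ys ∷ʳ z)) (≡ᵇ-false x≢y)) ⟩
  (z ≡ᵇ y) ▸ ∑ (insertAll x ys) G ℚ.+ 0ℚ
    ≡⟨ ℚ.+-identityʳ _ ⟩
  (z ≡ᵇ y) ▸ ∑ (insertAll x ys) G
    ≡⟨ atLast-∷ʳ y (λ p → ∑ (insertAll x p) G) ys z ⟨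
  atLast y (λ p → ∑ (insertAll x p) G) (ys ∷ʳ z)
    ∎
  where open ≡-Reasoning

∑-perms-atLast : ∀ {y} xs → All (_≢ y) xs → (G : List ℕ → ℚ) → ∑ (perms (xs ∷ʳ y)) (atLast y G) ≡ ∑ (perms xs) G
∑-perms-atLast {y} []       []           G = cong (λ b → b ▸ G [] ℚ.+ 0ℚ) (≡ᵇ-true {y} refl)
∑-perms-atLast {y} (x ∷ xs) (x≢y ∷ xs≢y) G = begin
  ∑ (concatMap (insertAll x) (perms (xs ∷ʳ y))) (atLast y G)
    ≡⟨ ∑-concatMap (insertAll x) (perms (xs ∷ʳ y)) (atLast y G) ⟩
  ∑[ q ∈ perms (xs ∷ʳ y) ] ∑ (insertAll x q) (atLast y G)
    ≡⟨ ∑-ext (perms (xs ∷ʳ y)) (∑-insertAll-atLast x≢y G) ⟩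
  ∑ (perms (xs ∷ʳ y)) (atLast y (λ p → ∑ (insertAll x p) G))
    ≡⟨ ∑-perms-atLast xs xs≢y (λ p → ∑ (insertAll x p) G) ⟩
  ∑[ p ∈ perms xs ] ∑ (insertAll x p) G
    ≡⟨ ∑-concatMap (insertAll x) (perms xs) G ⟨
  ∑ (concatMap (insertAll x) (perms xs)) G
    ∎
  where open ≡-Reasoning

signings-∣∣ : ∀ ys → All (λ s → map ∣_∣ s ≡ ys) (signings ys)
signings-∣∣ []       = refl ∷ []
signings-∣∣ (y ∷ ys) = All.concat⁺ (All.map⁺ (All.map both-signs (signings-∣∣ ys)))
  where
  both-signs : ∀ {s} → map ∣_∣ s ≡ ys → All (λ s → map ∣_∣ s ≡ y ∷ ys) ((+ y ∷ s) ∷ (ℤ.- (+ y) ∷ s) ∷ [])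
  both-signs ∣s∣≡ys = cong (y ∷_) ∣s∣≡ys ∷ cong₂ _∷_ (ℤ.∣-i∣≡∣i∣ (+ y)) ∣s∣≡ys ∷ []

∑-signings-∷ʳ : ∀ ys x (f : List ℤ → ℚ) →
  ∑ (signings (ys ∷ʳ x)) f ≡ ∑[ s ∈ signings ys ] (f (s ∷ʳ + x) ℚ.+ f (s ∷ʳ ℤ.- (+ x)))
∑-signings-∷ʳ []       x f = sym (ℚ.+-assoc (f [ + x ]) (f [ ℤ.- (+ x) ]) 0ℚ)
∑-signings-∷ʳ (y ∷ ys) x f = begin
  ∑ (concatMap both-signs (signings (ys ∷ʳ x))) f
    ≡⟨ ∑-concatMap both-signs (signings (ys ∷ʳ x)) f ⟩
  ∑[ t ∈ signings (ys ∷ʳ x) ] ∑ (both-signs t) f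
    ≡⟨ ∑-signings-∷ʳ ys x (λ t → ∑ (both-signs t) f) ⟩
  ∑[ s ∈ signings ys ] (∑ (both-signs (s ∷ʳ + x)) f ℚ.+ ∑ (both-signs (s ∷ʳ ℤ.- (+ x))) f)
    ≡⟨ ∑-ext (signings ys) (λ s → regroup (f (+ y ∷ s ∷ʳ + x)) (f (ℤ.- (+ y) ∷ s ∷ʳ + x))
                                          (f (+ y ∷ s ∷ʳ ℤ.- (+ x))) (f (ℤ.- (+ y) ∷ s ∷ʳ ℤ.- (+ x)))) ⟩
  ∑[ s ∈ signings ys ] ∑ (both-signs s) (λ t → f (t ∷ʳ + x) ℚ.+ f (t ∷ʳ ℤ.- (+ x)))
    ≡⟨ ∑-concatMap both-signs (signings ys) (λ t → f (t ∷ʳ + x) ℚ.+ f (t ∷ʳ ℤ.- (+ x))) ⟨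
  ∑[ t ∈ concatMap both-signs (signings ys) ] (f (t ∷ʳ + x) ℚ.+ f (t ∷ʳ ℤ.- (+ x))) ∎
  where
  open ≡-Reasoning
  open +-*-Solver
  both-signs : List ℤ → List (List ℤ)
  both-signs s = (+ y ∷ s) ∷ (ℤ.- (+ y) ∷ s) ∷ []
  regroup : ∀ a b c d → (a ℚ.+ (b ℚ.+ 0ℚ)) ℚ.+ (c ℚ.+ (d ℚ.+ 0ℚ)) ≡ (a ℚ.+ c) ℚ.+ ((b ℚ.+ d) ℚ.+ 0ℚ)
  regroup = solve 4 (λ a b c d → (a :+ (b :+ con 0ℚ)) :+ (c :+ (d :+ con 0ℚ)) := (a :+ c) :+ ((b :+ d) :+ con 0ℚ)) refl

neg-∷ʳ : ∀ s z → neg (s ∷ʳ z) ≡ 𝟙 (isNeg z) + neg s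
neg-∷ʳ = count-∷ʳ isNeg

negAbsSum-∷ʳ : ∀ s z → negAbsSum (s ∷ʳ z) ≡ negAbsSum s + (if isNeg z then ∣ z ∣ else 0)
negAbsSum-∷ʳ []      z = ℕ.+-identityʳ _
negAbsSum-∷ʳ (a ∷ s) z = trans (cong (_+_ ∣a∣⁻) (negAbsSum-∷ʳ s z)) (sym (ℕ.+-assoc ∣a∣⁻ _ _))
  where ∣a∣⁻ = if isNeg a then ∣ a ∣ else 0

inv-∷ʳ : ∀ s z → inv (s ∷ʳ z) ≡ inv s + count (z <ℤᵇ_) s
inv-∷ʳ []      z = refl
inv-∷ʳ (a ∷ s) z = begin
  count (_<ℤᵇ a) (s ∷ʳ z) + inv (s ∷ʳ z)           ≡⟨ cong₂ _+_ (count-∷ʳ (_<ℤᵇ a) s z) (inv-∷ʳ s z) ⟩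
  (𝟙 (z <ℤᵇ a) + below-a) + (inv s + below-z)       ≡⟨ shuffle (𝟙 (z <ℤᵇ a)) below-a (inv s) below-z ⟩
  (below-a + inv s) + (𝟙 (z <ℤᵇ a) + below-z)       ≡⟨ cong (_+_ (below-a + inv s)) (count-∷ (z <ℤᵇ_) a s) ⟨
  inv (a ∷ s) + count (z <ℤᵇ_) (a ∷ s)             ∎
  where
  open ≡-Reasoning
  below-a = count (_<ℤᵇ a) s
  below-z = count (z <ℤᵇ_) s
  shuffle : ∀ b c i k → (b + c) + (i + k) ≡ (c + i) + (b + k)
  shuffle = solve-∀

noFixFrom-∷ʳ : ∀ i s z → noFixFrom i (s ∷ʳ z) ≡ noFixFrom i s ∧ noFixFrom (i + length s) [ z ]
noFixFrom-∷ʳ i []      z = cong (λ j → noFixFrom j [ z ]) (sym (ℕ.+-identityʳ i))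
noFixFrom-∷ʳ i (a ∷ s) z = begin
  fixes a ∧ noFixFrom (suc i) (s ∷ʳ z)
    ≡⟨ cong (fixes a ∧_) (noFixFrom-∷ʳ (suc i) s z) ⟩
  fixes a ∧ (noFixFrom (suc i) s ∧ noFixFrom (suc i + length s) [ z ])
    ≡⟨ Bool.∧-assoc (fixes a) _ _ ⟨
  (fixes a ∧ noFixFrom (suc i) s) ∧ noFixFrom (suc i + length s) [ z ]
    ≡⟨ cong (λ j → (fixes a ∧ noFixFrom (suc i) s) ∧ noFixFrom j [ z ]) (ℕ.+-suc i (length s)) ⟨
  noFixFrom i (a ∷ s) ∧ noFixFrom (i + length (a ∷ s)) [ z ]
    ∎
  where
  open ≡-Reasoning
  fixes : ℤ → Bool
  fixes a = not ((a ℤ.≤ᵇ + i) ∧ (+ i ℤ.≤ᵇ a))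

noFixFrom-+ : ∀ i x → noFixFrom i [ + x ] ≡ not (x ≡ᵇ i)
noFixFrom-+ i x = trans (Bool.∧-identityʳ _) (cong not (≡ᵇ-via-≤ᵇ x i))

lastPositive-∷ʳ : ∀ s z → lastPositive (s ∷ʳ z) ≡ not (isNeg z)
lastPositive-∷ʳ []          z = refl
lastPositive-∷ʳ (a ∷ [])    z = refl
lastPositive-∷ʳ (a ∷ b ∷ s) z = lastPositive-∷ʳ (b ∷ s) z

Dmaj-∷ʳ : ∀ s z → Dmaj (s ∷ʳ z) ≡ fmaj (s ∷ʳ + ∣ z ∣)
Dmaj-∷ʳ s z = cong fmaj (absLast-∷ʳ s)
  where
  absLast-∷ʳ : ∀ s → absLast (s ∷ʳ z) ≡ s ∷ʳ + ∣ z ∣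
  absLast-∷ʳ []          = refl
  absLast-∷ʳ (a ∷ [])    = refl
  absLast-∷ʳ (a ∷ b ∷ s) = cong (a ∷_) (absLast-∷ʳ (b ∷ s))

neg≤ellB : ∀ σ → neg σ ≤ ellB σ
neg≤ellB σ = ℕ.≤-trans (neg≤negAbsSum σ) (ℕ.m≤n+m (negAbsSum σ) (inv σ))
  where
  neg≤negAbsSum : ∀ σ → neg σ ≤ negAbsSum σ
  neg≤negAbsSum []             = z≤n
  neg≤negAbsSum ((+ k) ∷ σ)    = neg≤negAbsSum σ
  neg≤negAbsSum (-[1+ k ] ∷ σ) = s≤s (ℕ.≤-trans (neg≤negAbsSum σ) (ℕ.m≤n+m (negAbsSum σ) k))

module _ {s : List ℤ} {x : ℕ}
         (fresh : All (λ a → ∣ a ∣ ≢ suc x) s) (below : count (_<ᵇ suc x) (map ∣_∣ s) ≡ x) where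

  ellB-flip-last : ellB (s ∷ʳ -[1+ x ]) ≡ ellB (s ∷ʳ + suc x) + suc (2 * x)
  ellB-flip-last = begin
    inv (s ∷ʳ -[1+ x ]) + negAbsSum (s ∷ʳ -[1+ x ])
      ≡⟨ cong₂ _+_ (inv-∷ʳ s -[1+ x ]) (negAbsSum-∷ʳ s -[1+ x ]) ⟩
    (inv s + count (-[1+ x ] <ℤᵇ_) s) + (negAbsSum s + suc x)
      ≡⟨ cong (λ c → (inv s + c) + (negAbsSum s + suc x)) count-flip ⟩
    (inv s + (C + x)) + (negAbsSum s + suc x)
      ≡⟨ arithmetic (inv s) C (negAbsSum s) x ⟩
    ((inv s + C) + (negAbsSum s + 0)) + suc (2 * x)
      ≡⟨ cong (_+ suc (2 * x)) (cong₂ _+_ (inv-∷ʳ s (+ suc x)) (negAbsSum-∷ʳ s (+ suc x))) ⟨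
    ellB (s ∷ʳ + suc x) + suc (2 * x) ∎
    where
    open ≡-Reasoning
    C = count ((+ suc x) <ℤᵇ_) s
    count-flip : count (-[1+ x ] <ℤᵇ_) s ≡ C + x
    count-flip = begin
      count (-[1+ x ] <ℤᵇ_) s                       ≡⟨ count-split (-[1+ x ] <ℤᵇ_) ((+ suc x) <ℤᵇ_) ((_<ᵇ suc x) ∘ ∣_∣)
                                                                   (All.map (λ {a} → <ℤᵇ-flip x {a}) fresh) ⟩
      C + count ((_<ᵇ suc x) ∘ ∣_∣) s               ≡⟨ cong (_+_ C) (count-map (_<ᵇ suc x) ∣_∣ s) ⟨
      C + count (_<ᵇ suc x) (map ∣_∣ s)             ≡⟨ cong (_+_ C) below ⟩
      C + x                                         ∎
    arithmetic : ∀ i c a x → (i + (c + x)) + (a + suc x) ≡ ((i + c) + (a + 0)) + suc (2 * x)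
    arithmetic = solve-∀

  ellD-flip-last : ellD (s ∷ʳ -[1+ x ]) ≡ ellD (s ∷ʳ + suc x) + 2 * x
  ellD-flip-last = begin
    ellB (s ∷ʳ -[1+ x ]) ∸ neg (s ∷ʳ -[1+ x ])  ≡⟨ cong₂ _∸_ ellB-flip-last (neg-∷ʳ s -[1+ x ]) ⟩
    (B + suc (2 * x)) ∸ suc (neg s)            ≡⟨ cong (_∸ suc (neg s)) (ℕ.+-suc B (2 * x)) ⟩
    (B + 2 * x) ∸ neg s                        ≡⟨ ℕ.+-∸-comm (2 * x) neg≤B ⟩
    (B ∸ neg s) + 2 * x                        ≡⟨ cong (λ k → (B ∸ k) + 2 * x) (neg-∷ʳ s (+ suc x)) ⟨
    ellD (s ∷ʳ + suc x) + 2 * x                ∎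
    where
    open ≡-Reasoning
    B = ellB (s ∷ʳ + suc x)
    neg≤B : neg s ≤ B
    neg≤B = subst (_≤ B) (neg-∷ʳ s (+ suc x)) (neg≤ellB (s ∷ʳ + suc x))

module _ {n : ℕ} {s : List ℤ} (bounded : All (λ a → ∣ a ∣ ≤ n) s) where

  ellB-∷ʳ-max : ellB (s ∷ʳ + n) ≡ ellB s
  ellB-∷ʳ-max = cong₂ _+_
    (trans (inv-∷ʳ s (+ n)) (trans (cong (_+_ (inv s)) none-above) (ℕ.+-identityʳ _)))
    (trans (negAbsSum-∷ʳ s (+ n)) (ℕ.+-identityʳ _))
    where
    none-above : count ((+ n) <ℤᵇ_) s ≡ 0
    none-above = count-none ((+ n) <ℤᵇ_) (All.map (λ {a} → <ℤᵇ-bounded {a = a}) bounded)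

  fmaj-∷ʳ-max : fmaj (s ∷ʳ + n) ≡ fmaj s
  fmaj-∷ʳ-max = cong₂ _+_ (cong (2 *_) (majFrom-∷ʳ-max 1 s (All.map (λ {a} → ≺ᵇ-bounded {a = a}) bounded))) (neg-∷ʳ s (+ n))
    where
    majFrom-∷ʳ-max : ∀ i s → All (λ a → ((+ n) ≺ᵇ a) ≡ false) s → majFrom i (s ∷ʳ + n) ≡ majFrom i s
    majFrom-∷ʳ-max i []          []         = refl
    majFrom-∷ʳ-max i (a ∷ [])    (n⊀a ∷ []) rewrite n⊀a = refl
    majFrom-∷ʳ-max i (a ∷ b ∷ s) (_ ∷ n⊀bs) = cong (_+_ (if b ≺ᵇ a then i else 0)) (majFrom-∷ʳ-max (suc i) (b ∷ s) n⊀bs)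

-- Powers of ±1

±1-square : ∀ {ε} → ε ≡ 1ℤ ⊎ ε ≡ -1ℤ → ε ℤ.* ε ≡ 1ℤ
±1-square (inj₁ refl) = refl
±1-square (inj₂ refl) = refl

module _ {ε : ℤ} (ε²≡1 : ε ℤ.* ε ≡ 1ℤ) where

  ^-2*-+ : ∀ m n → ε ^ (2 * m + n) ≡ ε ^ n
  ^-2*-+ m n = begin
    ε ^ (2 * m + n)           ≡⟨ ℤ.^-distribˡ-+-* ε (2 * m) n ⟩
    ε ^ (2 * m) ℤ.* ε ^ n     ≡⟨ cong (ℤ._* ε ^ n) (ℤ.^-*-assoc ε 2 m) ⟨
    (ε ^ 2) ^ m ℤ.* ε ^ n     ≡⟨ cong (λ e → e ^ m ℤ.* ε ^ n) (trans (cong (ε ℤ.*_) (ℤ.*-identityʳ ε)) ε²≡1) ⟩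
    1ℤ ^ m ℤ.* ε ^ n          ≡⟨ cong (ℤ._* ε ^ n) (ℤ.^-zeroˡ m) ⟩
    1ℤ ℤ.* ε ^ n              ≡⟨ ℤ.*-identityˡ (ε ^ n) ⟩
    ε ^ n                     ∎
    where open ≡-Reasoning

  ^-parity : ∀ n → ε ^ n ≡ (if even n then 1ℤ else ε)
  ^-parity zero = refl
  ^-parity (suc n) with even n | ^-parity n
  ... | true  | εⁿ≡1 = trans (cong (ε ℤ.*_) εⁿ≡1) (ℤ.*-identityʳ ε)
  ... | false | εⁿ≡ε = trans (cong (ε ℤ.*_) εⁿ≡ε) ε²≡1

  ^-fmaj : ∀ σ → ε ^ fmaj σ ≡ ε ^ neg σ
  ^-fmaj σ = ^-2*-+ (majPrec σ) (neg σ)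

  ^-ellB*^-fmaj : ∀ σ → ε ^ ellB σ ℤ.* ε ^ fmaj σ ≡ ε ^ ellD σ
  ^-ellB*^-fmaj σ = begin
    ε ^ ellB σ ℤ.* ε ^ fmaj σ        ≡⟨ cong (ε ^ ellB σ ℤ.*_) (^-fmaj σ) ⟩
    ε ^ ellB σ ℤ.* ε ^ neg σ         ≡⟨ ℤ.^-distribˡ-+-* ε (ellB σ) (neg σ) ⟨
    ε ^ (ellB σ + neg σ)             ≡⟨ cong (ε ^_) ellB+neg ⟩
    ε ^ (2 * neg σ + ellD σ)         ≡⟨ ^-2*-+ (neg σ) (ellD σ) ⟩
    ε ^ ellD σ                       ∎
    where
    open ≡-Reasoning
    ellB+neg : ellB σ + neg σ ≡ 2 * neg σ + ellD σ
    ellB+neg = trans (cong (_+ neg σ) (sym (ℕ.m∸n+n≡m (neg≤ellB σ)))) (rearrange (ellD σ) (neg σ))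
      where
      rearrange : ∀ d k → (d + k) + k ≡ 2 * k + d
      rearrange = solve-∀

-- (ε/2)(1 − (−1)^N) is ε = ε^N for odd N and 0 for even N.
half-sign-gap : ∀ {ε} → ε ≡ 1ℤ ⊎ ε ≡ -1ℤ → ∀ g L N →
  not (even N) ▸ g ▸ (ε ^ L ℤ.* ε ^ N) / 1
    ≡ ((ε / 1) ℚ.* ½) ℚ.* (g ▸ (ε ^ L) / 1 ℚ.- g ▸ (ε ^ L ℤ.* -1ℤ ^ N) / 1)
half-sign-gap {ε} ε=±1 false L N = trans (▸-0ℚ (not (even N))) (sym (ℚ.*-zeroʳ ((ε / 1) ℚ.* ½)))
half-sign-gap {ε} ε=±1 true  L N
  rewrite ^-parity {ε} (±1-square ε=±1) L | ^-parity {ε} (±1-square ε=±1) N | ^-parity { -1ℤ} refl N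
  with ε=±1 | even L | even N
... | inj₁ refl | true  | true  = refl
... | inj₁ refl | true  | false = refl
... | inj₁ refl | false | true  = refl
... | inj₁ refl | false | false = refl
... | inj₂ refl | true  | true  = refl
... | inj₂ refl | true  | false = refl
... | inj₂ refl | false | true  = refl
... | inj₂ refl | false | false = refl

-- The pairing σ ↔ σ̄

module Contributions {ε : ℤ} (ε=±1 : ε ≡ 1ℤ ⊎ ε ≡ -1ℤ) (k : ℕ) where

  D-term Δ-term B-term : List ℤ → ℚ
  D-term σ = even (neg σ) ▸ noFixFrom 1 σ ▸ (Dmaj σ ≡ᵇ k) ▸ (ε ^ ellD σ) / 1
  Δ-term σ = lastPositive σ ▸ noFixFrom 1 σ ▸ (fmaj σ ≡ᵇ k) ▸ (ε ^ ellB σ ℤ.* ε ^ fmaj σ) / 1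
  B-term σ = ((ε / 1) ℚ.* ½) ℚ.* (noFixFrom 1 σ ▸ (fmaj σ ≡ᵇ k) ▸ (ε ^ ellB σ) / 1
                                ℚ.- noFixFrom 1 σ ▸ (fmaj σ ≡ᵇ k) ▸ (ε ^ ellB σ ℤ.* -1ℤ ^ fmaj σ) / 1)

  private
    ε²≡1 : ε ℤ.* ε ≡ 1ℤ
    ε²≡1 = ±1-square ε=±1

  module _ {m x : ℕ} {s : List ℤ} (length≡ : length s ≡ m) (bounded : All (λ a → ∣ a ∣ ≤ suc m) s)
           (fresh : All (λ a → ∣ a ∣ ≢ suc x) s) (below : count (_<ᵇ suc x) (map ∣_∣ s) ≡ x) where

    private
      τ σ̄ : List ℤ
      τ = s ∷ʳ + suc x
      σ̄ = s ∷ʳ -[1+ x ]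

      e d f : Bool
      e = even (neg s)
      d = noFixFrom 1 s
      f = fmaj τ ≡ᵇ k

      v : ℚ
      v = (ε ^ ellD τ) / 1

      noFix-τ : noFixFrom 1 τ ≡ d ∧ not (x ≡ᵇ m)
      noFix-τ = begin
        noFixFrom 1 τ                                ≡⟨ noFixFrom-∷ʳ 1 s (+ suc x) ⟩
        d ∧ noFixFrom (suc (length s)) [ + suc x ]   ≡⟨ cong (λ l → d ∧ noFixFrom (suc l) [ + suc x ]) length≡ ⟩
        d ∧ noFixFrom (suc m) [ + suc x ]            ≡⟨ cong (d ∧_) (noFixFrom-+ (suc m) (suc x)) ⟩
        d ∧ not (x ≡ᵇ m)                             ∎
        where open ≡-Reasoning

      noFix-σ̄ : noFixFrom 1 σ̄ ≡ d
      noFix-σ̄ = trans (noFixFrom-∷ʳ 1 s -[1+ x ]) (Bool.∧-identityʳ d)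

      ^-ellD-σ̄ : ε ^ ellD σ̄ ≡ ε ^ ellD τ
      ^-ellD-σ̄ = begin
        ε ^ ellD σ̄              ≡⟨ cong (ε ^_) (ellD-flip-last fresh below) ⟩
        ε ^ (ellD τ + 2 * x)    ≡⟨ cong (ε ^_) (ℕ.+-comm (ellD τ) (2 * x)) ⟩
        ε ^ (2 * x + ellD τ)    ≡⟨ ^-2*-+ ε²≡1 x (ellD τ) ⟩
        ε ^ ellD τ              ∎
        where open ≡-Reasoning

      D-τ : D-term τ ≡ e ▸ (d ∧ not (x ≡ᵇ m)) ▸ f ▸ v
      D-τ = ▸-cong₃ (cong even (neg-∷ʳ s (+ suc x))) noFix-τ (cong (_≡ᵇ k) (Dmaj-∷ʳ s (+ suc x))) refl

      D-σ̄ : D-term σ̄ ≡ not e ▸ d ▸ f ▸ v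
      D-σ̄ = ▸-cong₃ (cong even (neg-∷ʳ s -[1+ x ])) noFix-σ̄ (cong (_≡ᵇ k) (Dmaj-∷ʳ s -[1+ x ])) (cong (_/ 1) ^-ellD-σ̄)

      Δ-τ : Δ-term τ ≡ (d ∧ not (x ≡ᵇ m)) ▸ f ▸ v
      Δ-τ = ▸-cong₃ (lastPositive-∷ʳ s (+ suc x)) noFix-τ refl (cong (_/ 1) (^-ellB*^-fmaj ε²≡1 τ))

      Δ-σ̄ : Δ-term σ̄ ≡ 0ℚ
      Δ-σ̄ = cong (λ b → b ▸ noFixFrom 1 σ̄ ▸ (fmaj σ̄ ≡ᵇ k) ▸ (ε ^ ellB σ̄ ℤ.* ε ^ fmaj σ̄) / 1)
                 (lastPositive-∷ʳ s -[1+ x ])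

      pair-inner : (x ≡ᵇ m) ≡ false → D-term τ ℚ.+ D-term σ̄ ≡ Δ-term τ ℚ.+ Δ-term σ̄
      pair-inner x≢m = begin
        D-term τ ℚ.+ D-term σ̄                          ≡⟨ cong₂ ℚ._+_ D-τ D-σ̄ ⟩
        e ▸ d′ ▸ f ▸ v ℚ.+ not e ▸ d ▸ f ▸ v            ≡⟨ cong (λ b → e ▸ b ▸ f ▸ v ℚ.+ not e ▸ d ▸ f ▸ v) d′≡d ⟩
        e ▸ d ▸ f ▸ v ℚ.+ not e ▸ d ▸ f ▸ v             ≡⟨ ▸-split e (d ▸ f ▸ v) ⟩
        d ▸ f ▸ v                                       ≡⟨ cong (λ b → b ▸ f ▸ v) d′≡d ⟨
        d′ ▸ f ▸ v                                      ≡⟨ ℚ.+-identityʳ _ ⟨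
        d′ ▸ f ▸ v ℚ.+ 0ℚ                               ≡⟨ cong₂ ℚ._+_ Δ-τ Δ-σ̄ ⟨
        Δ-term τ ℚ.+ Δ-term σ̄                          ∎
        where
        open ≡-Reasoning
        d′ = d ∧ not (x ≡ᵇ m)
        d′≡d : d′ ≡ d
        d′≡d = trans (cong (λ b → d ∧ not b) x≢m) (Bool.∧-identityʳ d)

      module _ (x≡m : x ≡ m) where

        fixed-at-n : d ∧ not (x ≡ᵇ m) ≡ false
        fixed-at-n = trans (cong (λ b → d ∧ not b) (≡ᵇ-true x≡m)) (Bool.∧-zeroʳ d)

        B-term-last : not e ▸ d ▸ f ▸ v ≡ B-term s
        B-term-last = begin
          not e ▸ d ▸ f ▸ v                                   ≡⟨ cong (not e ▸_) (∧-▸ d f v) ⟨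
          not e ▸ (d ∧ f) ▸ v                                 ≡⟨ cong (λ q → not e ▸ (d ∧ f) ▸ q / 1) ^-ellD-τ ⟩
          not e ▸ (d ∧ f) ▸ (ε ^ ellB τ ℤ.* ε ^ neg s) / 1   ≡⟨ half-sign-gap ε=±1 (d ∧ f) (ellB τ) (neg s) ⟩
          c ℚ.* ((d ∧ f) ▸ (ε ^ ellB τ) / 1 ℚ.- (d ∧ f) ▸ (ε ^ ellB τ ℤ.* -1ℤ ^ neg s) / 1)
            ≡⟨ cong (λ q → c ℚ.* ((d ∧ f) ▸ (ε ^ ellB τ) / 1 ℚ.- (d ∧ f) ▸ (ε ^ ellB τ ℤ.* q) / 1)) ^-neg-τ ⟨
          c ℚ.* ((d ∧ f) ▸ (ε ^ ellB τ) / 1 ℚ.- (d ∧ f) ▸ (ε ^ ellB τ ℤ.* -1ℤ ^ fmaj τ) / 1)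
            ≡⟨ cong₂ (λ p q → c ℚ.* (p ℚ.- q)) (∧-▸ d f _) (∧-▸ d f _) ⟩
          c ℚ.* (d ▸ f ▸ (ε ^ ellB τ) / 1 ℚ.- d ▸ f ▸ (ε ^ ellB τ ℤ.* -1ℤ ^ fmaj τ) / 1)
            ≡⟨ cong₂ (λ l j → c ℚ.* (d ▸ (j ≡ᵇ k) ▸ (ε ^ l) / 1 ℚ.- d ▸ (j ≡ᵇ k) ▸ (ε ^ l ℤ.* -1ℤ ^ j) / 1))
                     (ellB-∷ʳ-max bounded′) (fmaj-∷ʳ-max bounded′) ⟩
          B-term s                                            ∎
          where
          open ≡-Reasoning
          c = (ε / 1) ℚ.* ½
          bounded′ : All (λ a → ∣ a ∣ ≤ suc x) s
          bounded′ = subst (λ j → All (λ a → ∣ a ∣ ≤ suc j) s) (sym x≡m) bounded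
          ^-ellD-τ : ε ^ ellD τ ≡ ε ^ ellB τ ℤ.* ε ^ neg s
          ^-ellD-τ = trans (sym (^-ellB*^-fmaj ε²≡1 τ))
                           (cong (ε ^ ellB τ ℤ.*_) (trans (^-fmaj ε²≡1 τ) (cong (ε ^_) (neg-∷ʳ s (+ suc x)))))
          ^-neg-τ : -1ℤ ^ fmaj τ ≡ -1ℤ ^ neg s
          ^-neg-τ = trans (^-fmaj refl τ) (cong (-1ℤ ^_) (neg-∷ʳ s (+ suc x)))

        pair-last : D-term τ ℚ.+ D-term σ̄ ≡ (Δ-term τ ℚ.+ Δ-term σ̄) ℚ.+ B-term s
        pair-last = begin
          D-term τ ℚ.+ D-term σ̄                 ≡⟨ cong₂ ℚ._+_ (trans D-τ (cong (λ g → e ▸ g ▸ f ▸ v) fixed-at-n)) D-σ̄ ⟩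
          e ▸ 0ℚ ℚ.+ not e ▸ d ▸ f ▸ v           ≡⟨ cong₂ ℚ._+_ (▸-0ℚ e) B-term-last ⟩
          0ℚ ℚ.+ B-term s                        ≡⟨ cong (ℚ._+ B-term s) (cong₂ ℚ._+_ Δ-τ≡0 Δ-σ̄) ⟨
          (Δ-term τ ℚ.+ Δ-term σ̄) ℚ.+ B-term s  ∎
          where
          open ≡-Reasoning
          Δ-τ≡0 : Δ-term τ ≡ 0ℚ
          Δ-τ≡0 = trans Δ-τ (cong (λ g → g ▸ f ▸ v) fixed-at-n)

    pair : D-term (s ∷ʳ + suc x) ℚ.+ D-term (s ∷ʳ -[1+ x ])
             ≡ (Δ-term (s ∷ʳ + suc x) ℚ.+ Δ-term (s ∷ʳ -[1+ x ])) ℚ.+ (x ≡ᵇ m) ▸ B-term s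
    pair with x ≡ᵇ m in x≟m
    ... | false = trans (pair-inner x≟m) (sym (ℚ.+-identityʳ _))
    ... | true  = pair-last (ℕ.≡ᵇ⇒≡ x m (Equivalence.from Bool.T-≡ x≟m))

  ∑-signings-pair : ∀ {m x} ys → ys ∷ʳ suc x ↭ oneTo (suc m) →
    ∑ (signings (ys ∷ʳ suc x)) D-term ≡ ∑ (signings (ys ∷ʳ suc x)) Δ-term ℚ.+ (x ≡ᵇ m) ▸ ∑ (signings ys) B-term
  ∑-signings-pair {m} {x} ys arranged = begin
    ∑ (signings (ys ∷ʳ suc x)) D-term
      ≡⟨ ∑-signings-∷ʳ ys (suc x) D-term ⟩
    ∑[ s ∈ signings ys ] (D-term (s ∷ʳ + suc x) ℚ.+ D-term (s ∷ʳ -[1+ x ]))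
      ≡⟨ ∑-cong pair-over (signings-∣∣ ys) ⟩
    ∑[ s ∈ signings ys ] (Δ-pair s ℚ.+ (x ≡ᵇ m) ▸ B-term s)
      ≡⟨ ∑-+ (signings ys) Δ-pair (λ s → (x ≡ᵇ m) ▸ B-term s) ⟩
    ∑ (signings ys) Δ-pair ℚ.+ ∑[ s ∈ signings ys ] ((x ≡ᵇ m) ▸ B-term s)
      ≡⟨ cong₂ ℚ._+_ (sym (∑-signings-∷ʳ ys (suc x) Δ-term)) (∑-▸ (x ≡ᵇ m) (signings ys) B-term) ⟩
    ∑ (signings (ys ∷ʳ suc x)) Δ-term ℚ.+ (x ≡ᵇ m) ▸ ∑ (signings ys) B-term
      ∎
    where
    open ≡-Reasoning
    Δ-pair : List ℤ → ℚ
    Δ-pair s = Δ-term (s ∷ʳ + suc x) ℚ.+ Δ-term (s ∷ʳ -[1+ x ])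
    pair-over : ∀ {s} → map ∣_∣ s ≡ ys →
      D-term (s ∷ʳ + suc x) ℚ.+ D-term (s ∷ʳ -[1+ x ]) ≡ Δ-pair s ℚ.+ (x ≡ᵇ m) ▸ B-term s
    pair-over {s} ∣s∣≡ys = pair length≡ bounded fresh below
      where
      on-s : {P : ℕ → Set} → All P ys → All (P ∘ ∣_∣) s
      on-s = All.map⁻ ∘ subst (All _) (sym ∣s∣≡ys)
      length≡ : length s ≡ m
      length≡ = trans (sym (List.length-map ∣_∣ s)) (trans (cong length ∣s∣≡ys) (∷ʳ-↭-oneTo⇒length arranged))
      bounded : All (λ a → ∣ a ∣ ≤ suc m) s
      bounded = on-s (All.map proj₂ (proj₁ (∷ʳ-↭-oneTo⇒bounds arranged)))
      fresh : All (λ a → ∣ a ∣ ≢ suc x) s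
      fresh = on-s (∷ʳ-↭-oneTo⇒fresh arranged)
      below : count (_<ᵇ suc x) (map ∣_∣ s) ≡ x
      below = trans (cong (count (_<ᵇ suc x)) ∣s∣≡ys) (∷ʳ-↭-oneTo⇒below arranged refl)

  ∑-perm-signings : ∀ {m} p → p ↭ oneTo (suc m) →
    ∑ (signings p) D-term ≡ ∑ (signings p) Δ-term ℚ.+ atLast (suc m) (λ q → ∑ (signings q) B-term) p
  ∑-perm-signings {m} p arranged with initLast p
  ... | []       = contradiction (trans (↭-length arranged) (length-oneTo (suc m))) ℕ.0≢1+n
  ... | ys ∷ʳ′ x with proj₂ (∷ʳ-↭-oneTo⇒bounds arranged)
  ... | s≤s z≤n , _ = trans (∑-signings-pair ys arranged)
                              (cong (∑ (signings p) Δ-term ℚ.+_) (sym (atLast-∷ʳ (suc m) (λ q → ∑ (signings q) B-term) ys x)))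

  ∑-Bgroup-suc : ∀ m → ∑ (Bgroup (suc m)) D-term ≡ ∑ (Bgroup (suc m)) Δ-term ℚ.+ ∑ (Bgroup m) B-term
  ∑-Bgroup-suc m = begin
    ∑ (concatMap signings (perms (oneTo n))) D-term
      ≡⟨ ∑-concatMap signings (perms (oneTo n)) D-term ⟩
    ∑[ p ∈ perms (oneTo n) ] ∑ (signings p) D-term
      ≡⟨ ∑-cong (∑-perm-signings _) (perms-↭ (oneTo n)) ⟩
    ∑[ p ∈ perms (oneTo n) ] (∑ (signings p) Δ-term ℚ.+ atLast n G p)
      ≡⟨ ∑-+ (perms (oneTo n)) (λ p → ∑ (signings p) Δ-term) (atLast n G) ⟩
    ∑[ p ∈ perms (oneTo n) ] ∑ (signings p) Δ-term ℚ.+ ∑ (perms (oneTo n)) (atLast n G)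
      ≡⟨ cong₂ ℚ._+_ (sym (∑-concatMap signings (perms (oneTo n)) Δ-term)) last-is-n ⟩
    ∑ (Bgroup n) Δ-term ℚ.+ ∑ (Bgroup m) B-term
      ∎
    where
    open ≡-Reasoning
    n = suc m
    G : List ℕ → ℚ
    G q = ∑ (signings q) B-term
    n∉oneTo-m : All (_≢ n) (oneTo m)
    n∉oneTo-m = All.map (λ (_ , y≤m) → ℕ.<⇒≢ (s≤s y≤m)) (oneTo-bounds m)
    last-is-n : ∑ (perms (oneTo n)) (atLast n G) ≡ ∑ (Bgroup m) B-term
    last-is-n = begin
      ∑ (perms (oneTo n)) (atLast n G)          ≡⟨ cong (λ l → ∑ (perms l) (atLast n G)) (oneTo-suc m) ⟩
      ∑ (perms (oneTo m ∷ʳ n)) (atLast n G)     ≡⟨ ∑-perms-atLast (oneTo m) n∉oneTo-m G ⟩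
      ∑ (perms (oneTo m)) G                     ≡⟨ ∑-concatMap signings (perms (oneTo m)) B-term ⟨
      ∑ (Bgroup m) B-term                       ∎

  DerD-as-∑ : ∀ n → genfun (DerD n) (λ σ → ε ^ ellD σ) Dmaj k ≡ ∑ (Bgroup n) D-term
  DerD-as-∑ n = ∑-filterᵇ² (noFixFrom 1) (λ σ → even (neg σ)) (Bgroup n) (λ σ → (Dmaj σ ≡ᵇ k) ▸ (ε ^ ellD σ) / 1)

  DerΔ-as-∑ : ∀ n → genfun (DerΔ n) (λ σ → ε ^ ellB σ ℤ.* ε ^ fmaj σ) fmaj k ≡ ∑ (Bgroup n) Δ-term
  DerΔ-as-∑ n = ∑-filterᵇ² (noFixFrom 1) lastPositive (Bgroup n) (λ σ → (fmaj σ ≡ᵇ k) ▸ (ε ^ ellB σ ℤ.* ε ^ fmaj σ) / 1)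

  DerB-as-∑ : ∀ n →
    ((ε / 1) ℚ.* ½) ℚ.* (genfun (DerB n) (λ σ → ε ^ ellB σ) fmaj k
                        ℚ.- genfun (DerB n) (λ σ → ε ^ ellB σ ℤ.* -1ℤ ^ fmaj σ) fmaj k)
      ≡ ∑ (Bgroup n) B-term
  DerB-as-∑ n = trans (cong₂ (λ p q → c ℚ.* (p ℚ.- q)) (∑-filterᵇ (noFixFrom 1) (Bgroup n) t₁)
                                                         (∑-filterᵇ (noFixFrom 1) (Bgroup n) t₂))
                      (sym (∑-*-- c (Bgroup n) (λ σ → noFixFrom 1 σ ▸ t₁ σ) (λ σ → noFixFrom 1 σ ▸ t₂ σ)))
    where
    c : ℚ
    c = (ε / 1) ℚ.* ½
    t₁ t₂ : List ℤ → ℚ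
    t₁ σ = (fmaj σ ≡ᵇ k) ▸ (ε ^ ellB σ) / 1
    t₂ σ = (fmaj σ ≡ᵇ k) ▸ (ε ^ ellB σ ℤ.* -1ℤ ^ fmaj σ) / 1

lemma4p8 : (ε : ℤ) → (ε ≡ 1ℤ ⊎ ε ≡ -1ℤ) → (n : ℕ) → 2 ≤ n →
    genfun (DerD n) (λ σ → ε ^ ellD σ) Dmaj
      ≈ₚ
    (genfun (DerΔ n) (λ σ → (ε ^ ellB σ) ℤ.* (ε ^ fmaj σ)) fmaj
      +ₚ
     ((ε / 1) ℚ.* ½) ·ₚ
       (genfun (DerB (pred n)) (λ σ → ε ^ ellB σ) fmaj
         -ₚ
        genfun (DerB (pred n)) (λ σ → (ε ^ ellB σ) ℤ.* (-1ℤ ^ fmaj σ)) fmaj))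
lemma4p8 ε ε=±1 (suc m) (s≤s _) k = begin
  genfun (DerD (suc m)) (λ σ → ε ^ ellD σ) Dmaj k         ≡⟨ DerD-as-∑ (suc m) ⟩
  ∑ (Bgroup (suc m)) D-term                                ≡⟨ ∑-Bgroup-suc m ⟩
  ∑ (Bgroup (suc m)) Δ-term ℚ.+ ∑ (Bgroup m) B-term        ≡⟨ cong₂ ℚ._+_ (DerΔ-as-∑ (suc m)) (DerB-as-∑ m) ⟨
  genfun (DerΔ (suc m)) (λ σ → ε ^ ellB σ ℤ.* ε ^ fmaj σ) fmaj k ℚ.+
    ((ε / 1) ℚ.* ½) ℚ.* (genfun (DerB m) (λ σ → ε ^ ellB σ) fmaj k
                        ℚ.- genfun (DerB m) (λ σ → ε ^ ellB σ ℤ.* -1ℤ ^ fmaj σ) fmaj k)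
                                                           ∎
  where
  open ≡-Reasoning
  open Contributions ε=±1 k
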